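{- Let $D$ and $E$ be distributions of pegs on finite simple graphs $G$ and $H$ respectively. Then $\mathrm{Reach}(D)\times\mathrm{Reach}(E)\subseteq \mathrm{Reach}(D\times E)$, where $D\times E$ is viewed as a distribution on the Cartesian product $G\times H$.
   Context: The Cartesian product $G\times H$ has vertex set $V(G)\times V(H)$, with $(g,h)$ adjacent to $(g',h')$ iff either $g=g'$ and $hh'\in E(H)$, or $h=h'$ and $gg'\in E(G)$. A distribution of pegs on a graph $\Gamma$ is a subset $D \subseteq V(\Gamma)$. If $u,v \in D$ are distinct adjacent vertices and $w \notin D$ is a vertex adjacent to $v$, the pegging move (jumping $u$ over $v$ into $w$) replaces $D$ by $(D\setminus\{u,v\})\cup\{w\}$. $\mathrm{Reach}(D)$ is the set of vertices $t$ such that some finite (possibly empty) sequence of pegging moves starting from $D$ ends in a distribution containing $t$. -}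

module Defs where

open import Data.Nat using (ℕ)
open import Data.Fin using (Fin)
open import Data.Fin.Properties using () renaming (_≟_ to _≟ᶠ_)
open import Data.Bool using (Bool; true; false; _∧_)
open import Data.Product using (_×_; _,_; Σ; ∃; proj₁; proj₂)
open import Data.Product.Properties using (≡-dec)
open import Relation.Binary.PropositionalEquality using (_≡_)
open import Relation.Nullary using (¬_; Dec; yes; no)
open import Relation.Binary.Definitions using (DecidableEquality)

record Graph (n : ℕ) : Set₁ where
  field
    Adj   : Fin n → Fin n → Set
    sym   : ∀ {x y} → Adj x y → Adj y x
    irrefl : ∀ {x} → ¬ Adj x x

-- General (possibly non-Fin) vertex sets are needed for the product,
-- whose vertex set is Fin n × Fin m.  A "graph structure" on a type V:
record GraphOn (V : Set) : Set₁ where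
  field
    Adj : V → V → Set

toGraphOn : ∀ {n} → Graph n → GraphOn (Fin n)
toGraphOn G = record { Adj = Graph.Adj G }

data ProdAdj {n m : ℕ} (G : Graph n) (H : Graph m) : Fin n × Fin m → Fin n × Fin m → Set where
  sameG : ∀ {g h h'} → Graph.Adj H h h' → ProdAdj G H (g , h) (g , h')
  sameH : ∀ {g g' h} → Graph.Adj G g g' → ProdAdj G H (g , h) (g' , h)

_□_ : ∀ {n m} → Graph n → Graph m → GraphOn (Fin n × Fin m)
G □ H = record { Adj = ProdAdj G H }

Distribution : Set → Set
Distribution V = V → Bool

set : ∀ {V : Set} → DecidableEquality V → Distribution V → V → Bool → Distribution V
set _≟_ D x b y with y ≟ x
... | yes _ = b
... | no  _ = D y

-- One pegging move: u,v ∈ D distinct adjacent, w ∉ D adjacent to v;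
-- D ↦ (D ∖ {u,v}) ∪ {w}.  (Distinctness of u,v, and w ∉ {u,v}, follow from
-- irreflexivity / membership, but distinctness u ≢ v is stated explicitly.)
data Move {V : Set} (eq : DecidableEquality V) (Γ : GraphOn V) (D : Distribution V) : Distribution V → Set where
  jump : ∀ u v w → ¬ u ≡ v → GraphOn.Adj Γ u v → GraphOn.Adj Γ v w →
         D u ≡ true → D v ≡ true → D w ≡ false →
         Move eq Γ D (set eq (set eq (set eq D u false) v false) w true)

data Moves {V : Set} (eq : DecidableEquality V) (Γ : GraphOn V) : Distribution V → Distribution V → Set where
  done : ∀ {D} → Moves eq Γ D D
  step : ∀ {D D' D''} → Move eq Γ D D' → Moves eq Γ D' D'' → Moves eq Γ D D''

Reach : {V : Set} (eq : DecidableEquality V) (Γ : GraphOn V) → Distribution V → V → Set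
Reach eq Γ D t = ∃ λ D' → Moves eq Γ D D' × D' t ≡ true

ReachG : ∀ {n} → Graph n → Distribution (Fin n) → Fin n → Set
ReachG G = Reach _≟ᶠ_ (toGraphOn G)

_⊗_ : ∀ {n m} → Distribution (Fin n) → Distribution (Fin m) → Distribution (Fin n × Fin m)
(D ⊗ E) (g , h) = D g ∧ E h

ReachProd : ∀ {n m} → Graph n → Graph m → Distribution (Fin n × Fin m) → Fin n × Fin m → Set
ReachProd G H = Reach (≡-dec _≟ᶠ_ _≟ᶠ_) (G □ H)

-- Play the moves of E → E' inside every column {x} × H with x ∈ D (columns with
-- x ∉ D are empty, hence already agree with D × E'); this turns D × E into D × E'.
-- Since h ∈ E', the row G × {h} of D × E' is a copy of D, so the moves of D → D'
-- can then be played inside that row, bringing a peg to (g , h).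
module Submission where

open import Defs
open import Data.Nat using (ℕ)
open import Data.Fin using (Fin)
open import Data.Fin.Properties using () renaming (_≟_ to _≟ᶠ_)
open import Data.Bool using (true; false; _∧_)
open import Data.Bool.Properties using (∧-identityʳ)
open import Data.List using (List; []; _∷_)
open import Data.List.Membership.Propositional using (_∈_; _∉_)
open import Data.List.Membership.Propositional.Properties using (∈-allFin)
open import Data.List.Relation.Unary.Any using (here; there)
open import Data.List.Relation.Unary.All as All using (All)
open import Data.List.Relation.Unary.All.Properties using (All¬⇒¬Any)
open import Data.List.Relation.Unary.Unique.Propositional using (Unique; []; _∷_)
open import Data.List.Relation.Unary.Unique.Propositional.Properties using (allFin⁺)
open import Data.Product using (_×_; _,_; ∃)
open import Data.Product.Properties using (≡-dec; ,-injectiveˡ; ,-injectiveʳ)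
open import Function using (_∘_)
open import Function.Definitions using (Injective)
open import Relation.Nullary using (yes; no; contradiction)
open import Relation.Binary.Definitions using (DecidableEquality)
open import Relation.Binary.PropositionalEquality

module _ {V : Set} (_≟_ : DecidableEquality V) where

  set-≡ : ∀ D {x y} b → y ≡ x → set _≟_ D x b y ≡ b
  set-≡ D {x} {y} b y≡x with y ≟ x
  ... | yes _   = refl
  ... | no y≢x = contradiction y≡x y≢x

  set-≢ : ∀ D {x y} b → y ≢ x → set _≟_ D x b y ≡ D y
  set-≢ D {x} {y} b y≢x with y ≟ x
  ... | yes y≡x = contradiction y≡x y≢x
  ... | no _    = refl

  set-cong : ∀ {D D′} → D ≗ D′ → ∀ x b → set _≟_ D x b ≗ set _≟_ D′ x b
  set-cong D≗D′ x b y with y ≟ x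
  ... | yes _ = refl
  ... | no _  = D≗D′ y

  afterJump : Distribution V → V → V → V → Distribution V
  afterJump D u v w = set _≟_ (set _≟_ (set _≟_ D u false) v false) w true

  afterJump-cong : ∀ {D D′} → D ≗ D′ → ∀ u v w → afterJump D u v w ≗ afterJump D′ u v w
  afterJump-cong D≗D′ u v w =
    set-cong (set-cong (set-cong D≗D′ u false) v false) w true

-- Reachability up to pointwise equality of distributions: Moves is indexed by
-- functions, which are not identified when merely extensionally equal.
module Reachability {V : Set} (eq : DecidableEquality V) (Γ : GraphOn V) where

  infix 4 _⇝_
  _⇝_ : Distribution V → Distribution V → Set
  A ⇝ B = ∃ λ C → Moves eq Γ A C × C ≗ B

  Moves-++ : ∀ {A B C} → Moves eq Γ A B → Moves eq Γ B C → Moves eq Γ A C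
  Moves-++ done         ms′ = ms′
  Moves-++ (step mv ms) ms′ = step mv (Moves-++ ms ms′)

  Moves-resp-≗ : ∀ {A A′ B} → A ≗ A′ → Moves eq Γ A B → ∃ λ B′ → Moves eq Γ A′ B′ × B ≗ B′
  Moves-resp-≗ A≗A′ done = _ , done , A≗A′
  Moves-resp-≗ {A} {A′} A≗A′ (step (jump u v w u≢v uv vw Au Av Aw) ms)
    with Moves-resp-≗ (afterJump-cong eq A≗A′ u v w) ms
  ... | B′ , ms′ , B≗B′ =
    B′ , step (jump u v w u≢v uv vw (transport u Au) (transport v Av) (transport w Aw)) ms′ , B≗B′
    where
    transport : ∀ x {b} → A x ≡ b → A′ x ≡ b
    transport x = trans (sym (A≗A′ x))

  ⇝-reflexive : ∀ {A B} → A ≗ B → A ⇝ B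
  ⇝-reflexive A≗B = _ , done , A≗B

  ⇝-refl : ∀ {A} → A ⇝ A
  ⇝-refl = ⇝-reflexive λ _ → refl

  ⇝-step : ∀ {A B C} → Move eq Γ A B → B ⇝ C → A ⇝ C
  ⇝-step mv (C′ , ms , C′≗C) = C′ , step mv ms , C′≗C

  ⇝-trans : ∀ {A B C} → A ⇝ B → B ⇝ C → A ⇝ C
  ⇝-trans (B′ , ms₁ , B′≗B) (C′ , ms₂ , C′≗C) with Moves-resp-≗ (sym ∘ B′≗B) ms₂
  ... | C″ , ms₂′ , C′≗C″ = C″ , Moves-++ ms₁ ms₂′ , λ x → trans (sym (C′≗C″ x)) (C′≗C x)

  ⇝-Reach : ∀ {A B t} → A ⇝ B → B t ≡ true → Reach eq Γ A t
  ⇝-Reach {t = t} (C , ms , C≗B) Bt = C , ms , trans (C≗B t) Bt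

module Embedding {V W : Set} (_≟ᵥ_ : DecidableEquality V) (_≟w_ : DecidableEquality W)
                 (Γᵥ : GraphOn V) (Γw : GraphOn W) (f : V → W)
                 (f-injective : Injective _≡_ _≡_ f)
                 (f-adj : ∀ {x y} → GraphOn.Adj Γᵥ x y → GraphOn.Adj Γw (f x) (f y)) where

  open Reachability _≟w_ Γw

  OffImage : W → Set
  OffImage z = ∀ x → z ≢ f x

  set-∘ : ∀ P u b → set _≟w_ P (f u) b ∘ f ≗ set _≟ᵥ_ (P ∘ f) u b
  set-∘ P u b x with x ≟ᵥ u
  ... | yes x≡u = set-≡ _≟w_ P b (cong f x≡u)
  ... | no x≢u  = set-≢ _≟w_ P b (x≢u ∘ f-injective)

  afterJump-∘ : ∀ P u v w → afterJump _≟w_ P (f u) (f v) (f w) ∘ f ≗ afterJump _≟ᵥ_ (P ∘ f) u v w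
  afterJump-∘ P u v w x =
    trans (set-∘ _ w true x) (set-cong _≟ᵥ_ restrict₂ w true x)
    where
    restrict₁ = set-∘ P u false
    restrict₂ = λ y → trans (set-∘ _ v false y) (set-cong _≟ᵥ_ restrict₁ v false y)

  afterJump-off : ∀ P u v w {z} → OffImage z → afterJump _≟w_ P (f u) (f v) (f w) z ≡ P z
  afterJump-off P u v w {z} z-off =
    trans (set-≢ _≟w_ _ true (z-off w))
      (trans (set-≢ _≟w_ _ false (z-off v)) (set-≢ _≟w_ P false (z-off u)))

  Moves-lift : ∀ {D D′ P} → Moves _≟ᵥ_ Γᵥ D D′ → P ∘ f ≗ D →
               ∃ λ P′ → P ⇝ P′ × P′ ∘ f ≗ D′ × (∀ {z} → OffImage z → P′ z ≡ P z)
  Moves-lift done P∘f≗D = _ , ⇝-refl , P∘f≗D , λ _ → refl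
  Moves-lift {P = P} (step (jump u v w u≢v uv vw Du Dv Dw) ms) P∘f≗D
    with Moves-lift ms (λ x → trans (afterJump-∘ P u v w x) (afterJump-cong _≟ᵥ_ P∘f≗D u v w x))
  ... | P′ , P₁⇝P′ , P′∘f≗D′ , P′-off =
    P′ , ⇝-step image-move P₁⇝P′ , P′∘f≗D′ , λ z-off → trans (P′-off z-off) (afterJump-off P u v w z-off)
    where
    image-move = jump (f u) (f v) (f w) (u≢v ∘ f-injective) (f-adj uv) (f-adj vw)
                      (trans (P∘f≗D u) Du) (trans (P∘f≗D v) Dv) (trans (P∘f≗D w) Dw)

module Product {n m : ℕ} (G : Graph n) (H : Graph m) where

  open Reachability (≡-dec _≟ᶠ_ _≟ᶠ_) (G □ H) public

  module Column (x : Fin n) =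
    Embedding _≟ᶠ_ (≡-dec _≟ᶠ_ _≟ᶠ_) (toGraphOn H) (G □ H) (x ,_) ,-injectiveʳ sameG

  module Row (y : Fin m) =
    Embedding _≟ᶠ_ (≡-dec _≟ᶠ_ _≟ᶠ_) (toGraphOn G) (G □ H) (_, y) ,-injectiveˡ sameH

  module ColumnSweep (D : Distribution (Fin n)) {E E′ : Distribution (Fin m)}
                     (E→E′ : Moves _≟ᶠ_ (toGraphOn H) E E′) where

    ColumnsSwept : List (Fin n) → Distribution (Fin n × Fin m) → Set
    ColumnsSwept xs P = (∀ {x} → x ∈ xs → ∀ y → P (x , y) ≡ D x ∧ E′ y)
                      × (∀ {x} → x ∉ xs → ∀ y → P (x , y) ≡ D x ∧ E y)

    sweep-column : ∀ {x₀ xs P} → All (x₀ ≢_) xs → ColumnsSwept xs P →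
                   ∃ λ P′ → P ⇝ P′ × ColumnsSwept (x₀ ∷ xs) P′
    sweep-column {x₀} {xs} {P} x₀≢xs (swept , unswept) with D x₀ in Dx₀
    ... | false = P , ⇝-refl , swept′ , unswept ∘ (_∘ there)
      where
      swept′ : ∀ {x} → x ∈ x₀ ∷ xs → ∀ y → P (x , y) ≡ D x ∧ E′ y
      swept′ (here refl) y = trans (unswept (All¬⇒¬Any x₀≢xs) y)
                               (trans (cong (_∧ E y) Dx₀) (cong (_∧ E′ y) (sym Dx₀)))
      swept′ (there x∈xs)  = swept x∈xs
    ... | true
      with Column.Moves-lift x₀ E→E′ (λ y → trans (unswept (All¬⇒¬Any x₀≢xs) y) (cong (_∧ E y) Dx₀))
    ... | P′ , P⇝P′ , column≗E′ , off = P′ , P⇝P′ , swept′ , unswept′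
      where
      off-column : ∀ {x y} → x ≢ x₀ → P′ (x , y) ≡ P (x , y)
      off-column x≢x₀ = off λ _ → x≢x₀ ∘ ,-injectiveˡ
      swept′ : ∀ {x} → x ∈ x₀ ∷ xs → ∀ y → P′ (x , y) ≡ D x ∧ E′ y
      swept′ (here refl)  y = trans (column≗E′ y) (cong (_∧ E′ y) (sym Dx₀))
      swept′ (there x∈xs) y =
        trans (off-column (≢-sym (All.lookup x₀≢xs x∈xs))) (swept x∈xs y)
      unswept′ : ∀ {x} → x ∉ x₀ ∷ xs → ∀ y → P′ (x , y) ≡ D x ∧ E y
      unswept′ x∉ y = trans (off-column (x∉ ∘ here)) (unswept (x∉ ∘ there) y)

    sweep : ∀ xs → Unique xs → ∃ λ P → D ⊗ E ⇝ P × ColumnsSwept xs P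
    sweep []        []               = D ⊗ E , ⇝-refl , (λ ()) , λ _ _ → refl
    sweep (x₀ ∷ xs) (x₀≢xs ∷ unique) with sweep xs unique
    ... | P , D⊗E⇝P , swept with sweep-column x₀≢xs swept
    ... | P′ , P⇝P′ , swept′ = P′ , ⇝-trans D⊗E⇝P P⇝P′ , swept′

  ⊗-Movesʳ : ∀ D {E E′} → Moves _≟ᶠ_ (toGraphOn H) E E′ → D ⊗ E ⇝ D ⊗ E′
  ⊗-Movesʳ D E→E′ with ColumnSweep.sweep D E→E′ _ (allFin⁺ n)
  ... | P , D⊗E⇝P , swept , _ =
    ⇝-trans D⊗E⇝P (⇝-reflexive λ (x , y) → swept (∈-allFin x) y)

  ⊗-Movesˡ-row : ∀ {D D′ E h} → Moves _≟ᶠ_ (toGraphOn G) D D′ → E h ≡ true →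
                 ∃ λ P → D ⊗ E ⇝ P × ∀ x → P (x , h) ≡ D′ x
  ⊗-Movesˡ-row {D} {E = E} {h} D→D′ Eh =
    let P , D⊗E⇝P , row≗D′ , _ = Row.Moves-lift h D→D′ row≗D in P , D⊗E⇝P , row≗D′
    where
    row≗D : (D ⊗ E) ∘ (_, h) ≗ D
    row≗D x = trans (cong (D x ∧_) Eh) (∧-identityʳ (D x))

lemma5p2 : ∀ {n m : ℕ} (G : Graph n) (H : Graph m)
           (D : Distribution (Fin n)) (E : Distribution (Fin m))
           (g : Fin n) (h : Fin m) →
           ReachG G D g → ReachG H E h → ReachProd G H (D ⊗ E) (g , h)
lemma5p2 G H D E g h (D′ , D→D′ , D′g) (E′ , E→E′ , E′h) =
  let P , D⊗E′⇝P , row≗D′ = ⊗-Movesˡ-row D→D′ E′h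
  in  ⇝-Reach (⇝-trans (⊗-Movesʳ D E→E′) D⊗E′⇝P) (trans (row≗D′ g) D′g)
  where open Product G H
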